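{- Let $\alpha$ be an ordinal, let $\mathcal{F}$ be an ultrafilter on a set $I$, and for each $i\in I$ let $\mathfrak{A}_i$ be a substitution algebra of dimension $\alpha$ in which elements are strongly distinguished. Then elements are strongly distinguished in the ultraproduct $\prod\langle\mathfrak{A}_i:i\in I\rangle/\mathcal{F}$.
   Context: A substitution algebra of dimension $\alpha$ ($SA_\alpha$) is an algebra $\langle A,*_\kappa,v_\kappa\rangle_{\kappa<\alpha}$ satisfying, for all $\kappa,\lambda<\alpha$: (1) $x*_\kappa v_\kappa=x$; (2) $x*_\kappa v_\lambda=v_\lambda$ for $\kappa\neq\lambda$; (3) $v_\kappa*_\kappa x=x$; (4) if $w*_\lambda x=x$ for all $w$, then $x*_\lambda(v_\lambda*_\kappa z)=x*_\lambda(x*_\kappa z)$; (5) $(x*_\kappa y)*_\kappa z=x*_\kappa(y*_\kappa z)$; (6) if $w*_\lambda x=x$ for all $w$, then $x*_\kappa(y*_\lambda z)=(x*_\kappa y)*_\lambda(x*_\kappa z)$ for $\kappa\neq\lambda$. For $x\in A$, $\Delta x=\{\kappa<\alpha: a*_\kappa x\neq x\text{ for some }a\in A\}$, $Z=\{x\in A:\Delta x=\emptyset\}$. For $s\in A^\alpha$, $a\in A$, finite $\Sigma=\{\kappa_0<\dots<\kappa_{n-1}\}\subseteq\alpha$: $s*_{(\Sigma)}a=s_{\kappa_{n-1}}*_{\kappa_{n-1}}(\cdots(s_{\kappa_0}*_{\kappa_0}a)\cdots)$, with $s*_{(\emptyset)}a=a$. Elements are strongly distinguished in the algebra if for all $a,b\in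 A$: whenever for every $s\in Z^\alpha$ there is a finite $\Sigma\subseteq\alpha$ with $s*_{(\Sigma)}a=s*_{(\Sigma)}b$, then $a=b$. -}

module Defs where

open import Level using (0ℓ)
open import Data.Product using (Σ; ∃; _×_; _,_)
open import Data.Sum using (_⊎_)
open import Data.Empty using (⊥)
open import Data.Unit using (⊤)
open import Data.List using (List; []; _∷_)
open import Data.List.Relation.Unary.Linked using (Linked)
open import Relation.Nullary using (¬_)
open import Relation.Binary.PropositionalEquality using (_≡_; _≢_)
open import Relation.Binary.Structures using (IsStrictTotalOrder)
open import Induction.WellFounded using (WellFounded)

-- Ordinals: (up to isomorphism) a set with a well-founded strict total order.

record Ordinal : Set₁ where
  field
    Idx                : Set
    _<_                : Idx → Idx → Set
    isStrictTotalOrder : IsStrictTotalOrder _≡_ _<_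
    wellFounded        : WellFounded _<_

-- The notions Δ, Z and "strongly distinguished" only depend on this data.

module _ (α : Ordinal) where
  open Ordinal α

  record SubstStructure : Set₁ where
    infixl 7 _*[_]_
    infix 4 _≈_
    field
      Carrier : Set
      _≈_     : Carrier → Carrier → Set
      _*[_]_  : Carrier → Idx → Carrier → Carrier
      v       : Idx → Carrier

    _∈Δ_ : Idx → Carrier → Set
    κ ∈Δ x = ∃ λ a → ¬ (a *[ κ ] x ≈ x)

    Zero-dim : Carrier → Set
    Zero-dim x = ∀ κ → ¬ (κ ∈Δ x)

    -- finite subsets Σ of α, listed in strictly increasing order
    FinSub : Set
    FinSub = Σ (List Idx) (Linked _<_)

    -- s *_(Σ) a = s_{κ_{n-1}} *_{κ_{n-1}} ( ... (s_{κ_0} *_{κ_0} a) ...)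
    apply : (Idx → Carrier) → List Idx → Carrier → Carrier
    apply s []       a = a
    apply s (κ ∷ κs) a = apply s κs (s κ *[ κ ] a)

    _*⟨_⟩_ : (Idx → Carrier) → FinSub → Carrier → Carrier
    s *⟨ (κs , _) ⟩ a = apply s κs a

    StronglyDistinguished : Set
    StronglyDistinguished =
      ∀ a b →
      (∀ (s : Idx → Carrier) → (∀ κ → Zero-dim (s κ)) →
         ∃ λ (Σ' : FinSub) → (s *⟨ Σ' ⟩ a) ≈ (s *⟨ Σ' ⟩ b)) →
      a ≈ b

  record IsSubstAlg (A : SubstStructure) : Set where
    open SubstStructure A
    field
      ax1 : ∀ κ x → x *[ κ ] v κ ≈ x
      ax2 : ∀ κ λ' x → κ ≢ λ' → x *[ κ ] v λ' ≈ v λ'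
      ax3 : ∀ κ x → v κ *[ κ ] x ≈ x
      ax4 : ∀ κ λ' x z → (∀ w → w *[ λ' ] x ≈ x) →
            x *[ λ' ] (v λ' *[ κ ] z) ≈ x *[ λ' ] (x *[ κ ] z)
      ax5 : ∀ κ x y z → (x *[ κ ] y) *[ κ ] z ≈ x *[ κ ] (y *[ κ ] z)
      ax6 : ∀ κ λ' x y z → κ ≢ λ' → (∀ w → w *[ λ' ] x ≈ x) →
            x *[ κ ] (y *[ λ' ] z) ≈ (x *[ κ ] y) *[ λ' ] (x *[ κ ] z)

  mkStruct : (C : Set) → (C → Idx → C → C) → (Idx → C) → SubstStructure
  mkStruct C op w = record { Carrier = C ; _≈_ = _≡_ ; _*[_]_ = op ; v = w }

  record SA : Set₁ where
    field
      Carrier    : Set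
      _*[_]_     : Carrier → Idx → Carrier → Carrier
      v          : Idx → Carrier
      isSubstAlg : IsSubstAlg (mkStruct Carrier _*[_]_ v)

    struct : SubstStructure
    struct = mkStruct Carrier _*[_]_ v

record Ultrafilter (I : Set) : Set₁ where
  field
    Mem       : (I → Set) → Set
    whole     : Mem (λ _ → ⊤)
    proper    : ¬ (Mem (λ _ → ⊥))
    upward    : ∀ {X Y : I → Set} → (∀ i → X i → Y i) → Mem X → Mem Y
    intersect : ∀ {X Y : I → Set} → Mem X → Mem Y → Mem (λ i → X i × Y i)
    ultra     : ∀ (X : I → Set) → Mem X ⊎ Mem (λ i → ¬ X i)

-- The ultraproduct  ∏⟨A_i : i ∈ I⟩ / F, presented as a setoid:
-- elements are functions a with a i ∈ A_i, and a ≈ b iff {i | a i = b i} ∈ F.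

Ultraproduct : (α : Ordinal) {I : Set} (A : I → SA α) (F : Ultrafilter I) →
               SubstStructure α
Ultraproduct α {I} A F = record
  { Carrier = (i : I) → SA.Carrier (A i)
  ; _≈_     = λ a b → Mem (λ i → a i ≡ b i)
  ; _*[_]_  = λ a κ b i → SA._*[_]_ (A i) (a i) κ (b i)
  ; v       = λ κ i → SA.v (A i) κ
  }
  where open Ultrafilter F

module Submission where

open import Defs
open import Level using (0ℓ)
open import Axiom.ExcludedMiddle using (ExcludedMiddle)
open import Axiom.DoubleNegationElimination using (DoubleNegationElimination; em⇒dne)
open import Data.Product using (∃; _×_; _,_; proj₁; proj₂)
open import Data.Sum using (inj₁; inj₂)
open import Data.Empty using (⊥-elim)
open import Data.List using ([]; _∷_)
open import Relation.Nullary using (¬_; Dec; yes; no)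
open import Relation.Binary.PropositionalEquality using (_≡_; refl; trans; sym)

-- If a ≉ b, the coordinates where a and b differ form a set in F, and at each of
-- them strong distinguishedness of A_i classically yields a sequence of
-- zero-dimensional elements separating a i and b i under every finite Σ.
-- Gluing these gives a sequence of the ultraproduct: its entries are
-- zero-dimensional, since being fixed by all substitutions holds coordinatewise on
-- a set in F, and it separates a and b on a set in F for every Σ.  The hypothesis
-- then gives a Σ whose agreement set also lies in F, contradicting properness.

module _ {α : Ordinal} (A : SubstStructure α) where
  open Ordinal α
  open SubstStructure A

  Separates : (Idx → Carrier) → Carrier → Carrier → Set
  Separates s a b = (∀ κ → Zero-dim (s κ)) × (∀ Σ' → ¬ (s *⟨ Σ' ⟩ a ≈ s *⟨ Σ' ⟩ b))

  separating-sequence : DoubleNegationElimination 0ℓ → StronglyDistinguished →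
                        ∀ {a b} → ¬ (a ≈ b) → ∃ λ s → Separates s a b
  separating-sequence dne sd {a} {b} a≉b = dne λ noSep →
    a≉b (sd a b λ s zero-dim → dne λ noΣ →
      noSep (s , zero-dim , λ Σ' eq → noΣ (Σ' , eq)))

  Zero-dim⇒fixed : DoubleNegationElimination 0ℓ →
                   ∀ {x} → Zero-dim x → ∀ κ c → c *[ κ ] x ≈ x
  Zero-dim⇒fixed dne zero-dim κ c = dne λ moved → zero-dim κ (c , moved)

module _ {α : Ordinal} {I : Set} (F : Ultrafilter I) (A : I → SA α) where
  open Ordinal α
  open Ultrafilter F
  private
    module U = SubstStructure (Ultraproduct α A F)
    module S (i : I) = SubstStructure (SA.struct (A i))

  apply-pointwise : ∀ (s : Idx → U.Carrier) κs a i →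
                    U.apply s κs a i ≡ S.apply i (λ κ → s κ i) κs (a i)
  apply-pointwise s []       a i = refl
  apply-pointwise s (κ ∷ κs) a i = apply-pointwise s κs _ i

  Ultraproduct-Zero-dim : ∀ {x : U.Carrier} →
                          Mem (λ i → ∀ κ c → SA._*[_]_ (A i) c κ (x i) ≡ x i) →
                          U.Zero-dim x
  Ultraproduct-Zero-dim fixed κ (c , moved) =
    moved (upward (λ i fixedᵢ → fixedᵢ κ (c i)) fixed)

  module _ (em : ExcludedMiddle 0ℓ) (sd : ∀ i → S.StronglyDistinguished i) where
    private
      dne = em⇒dne em

      choose : ∀ i (x y : S.Carrier i) → Dec (x ≡ y) → Idx → S.Carrier i
      choose i x y (yes _)   κ = x
      choose i x y (no x≢y) κ = proj₁ (separating-sequence (SA.struct (A i)) dne (sd i) x≢y) κ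

      choose-separates : ∀ i {x y : S.Carrier i} → ¬ x ≡ y → (d : Dec (x ≡ y)) →
                         Separates (SA.struct (A i)) (choose i x y d) x y
      choose-separates i x≢y (yes x≡y) = ⊥-elim (x≢y x≡y)
      choose-separates i _   (no x≢y) = proj₂ (separating-sequence (SA.struct (A i)) dne (sd i) x≢y)

    Ultraproduct-separating-sequence :
      ∀ {a b : U.Carrier} → Mem (λ i → ¬ a i ≡ b i) →
      ∃ λ s → (∀ κ → U.Zero-dim (s κ)) ×
              (∀ Σ' → Mem (λ i → ¬ (s U.*⟨ Σ' ⟩ a) i ≡ (s U.*⟨ Σ' ⟩ b) i))
    Ultraproduct-separating-sequence {a} {b} differ = s , s-zero-dim , s-separates
      where
      s : Idx → U.Carrier
      s κ i = choose i (a i) (b i) em κ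

      s-zero-dim : ∀ κ → U.Zero-dim (s κ)
      s-zero-dim κ = Ultraproduct-Zero-dim (upward
        (λ i a≢b → Zero-dim⇒fixed (SA.struct (A i)) dne (proj₁ (choose-separates i a≢b em) κ))
        differ)

      s-separates : ∀ Σ' → Mem (λ i → ¬ (s U.*⟨ Σ' ⟩ a) i ≡ (s U.*⟨ Σ' ⟩ b) i)
      s-separates (κs , κs-increasing) = upward (λ i a≢b eq →
        proj₂ (choose-separates i a≢b em) (κs , κs-increasing)
          (trans (sym (apply-pointwise s κs a i)) (trans eq (apply-pointwise s κs b i))))
        differ

theorem3p5 : ExcludedMiddle 0ℓ →
    (α : Ordinal) (I : Set) (F : Ultrafilter I) (A : I → SA α) →
    (∀ i → SubstStructure.StronglyDistinguished (SA.struct (A i))) →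
    SubstStructure.StronglyDistinguished (Ultraproduct α A F)
theorem3p5 em α I F A sd a b agree with Ultrafilter.ultra F (λ i → a i ≡ b i)
... | inj₁ a≈b = a≈b
... | inj₂ differ =
  let s , s-zero-dim , s-separates = Ultraproduct-separating-sequence F A em sd differ
      Σ₀ , agreeOnΣ₀ = agree s s-zero-dim
  in  ⊥-elim (proper (upward (λ i (a≢b , agreeᵢ) → a≢b agreeᵢ) (intersect (s-separates Σ₀) agreeOnΣ₀)))
  where open Ultrafilter F
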